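{- Let $\pi:Y\to X$ be a surjective map between sets with $\#\pi^{ -1}(x)\le n$ for all $x\in X$, for some $n\in\mathbb{N}$, and let $\tilde{\mathcal{U}}$ be an ultrafilter on $Y$. Then for every $\tilde{W}\in\tilde{\mathcal{U}}$ there is $W\in\tilde{\mathcal{U}}$ with $W\subseteq\tilde{W}$ such that $W$ contains at most one point of each fibre $\pi^{ -1}(x)$, $x\in X$.
   Context: An ultrafilter on a set is a nonempty family of subsets not containing $\emptyset$, closed under finite intersections and supersets, and containing each subset or its complement. -}

module Defs where

open import Level using (Level; _⊔_; suc; Lift)
open import Data.Empty using (⊥)
open import Data.Nat using (ℕ)
open import Data.Fin using (Fin)
open import Data.Product using (Σ; ∃; _×_)
open import Data.Sum using (_⊎_)
open import Relation.Unary using (Pred; _∈_; _∉_; _⊆_; _∩_; ∁)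
open import Relation.Binary.PropositionalEquality using (_≡_)
open import Function.Bundles using (_↣_)

∅ₗ : ∀ {a} (ℓ : Level) {Y : Set a} → Pred Y ℓ
∅ₗ ℓ = λ _ → Lift ℓ ⊥

record IsUltrafilter {a ℓ ℓ'} {Y : Set a} (𝒰 : Pred (Pred Y ℓ) ℓ') : Set (a ⊔ suc ℓ ⊔ ℓ') where
  field
    nonempty   : ∃ λ (A : Pred Y ℓ) → A ∈ 𝒰
    no-empty   : ∅ₗ ℓ ∉ 𝒰
    ∩-closed   : ∀ {A B : Pred Y ℓ} → A ∈ 𝒰 → B ∈ 𝒰 → (A ∩ B) ∈ 𝒰
    up-closed  : ∀ {A B : Pred Y ℓ} → A ⊆ B → A ∈ 𝒰 → B ∈ 𝒰
    ultra      : ∀ (A : Pred Y ℓ) → A ∈ 𝒰 ⊎ ∁ A ∈ 𝒰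

Fibre : ∀ {a b} {Y : Set a} {X : Set b} → (Y → X) → X → Set (a ⊔ b)
Fibre {Y = Y} π x = Σ Y λ y → π y ≡ x

Surjective : ∀ {a b} {Y : Set a} {X : Set b} → (Y → X) → Set (a ⊔ b)
Surjective {Y = Y} {X} π = ∀ (x : X) → ∃ λ (y : Y) → π y ≡ x

FibresAtMost : ∀ {a b} {Y : Set a} {X : Set b} → (Y → X) → ℕ → Set (a ⊔ b)
FibresAtMost {X = X} π n = ∀ (x : X) → Fibre π x ↣ Fin n

AtMostOnePerFibre : ∀ {a b ℓ} {Y : Set a} {X : Set b} → (Y → X) → Pred Y ℓ → Set (a ⊔ b ⊔ ℓ)
AtMostOnePerFibre {Y = Y} π W = ∀ (y y' : Y) → W y → W y' → π y ≡ π y' → y ≡ y'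

-- Numbering the points of each fibre by Fin n splits Y into n index classes,
-- each meeting every fibre at most once. An ultrafilter containing a finite
-- cover of one of its members contains one of the covering sets, so some index
-- class lies in 𝒰, and its intersection with W̃ is the required W.
module Submission where

open import Defs
open import Level using (Lift; lift)
open import Data.Nat using (ℕ; zero; suc)
open import Data.Fin using (Fin; zero; suc)
open import Data.Empty using (⊥-elim)
open import Data.Product using (∃; _×_; _,_; proj₁; proj₂)
open import Data.Sum using (inj₁; inj₂)
open import Relation.Unary using (Pred; _∈_; _∉_; _⊆_; _∩_; ∁)
open import Relation.Binary.PropositionalEquality using (_≡_; refl; sym; trans; cong)
open import Function.Bundles using (Injection)

module UltrafilterProperties {a ℓ ℓ'} {Y : Set a} {𝒰 : Pred (Pred Y ℓ) ℓ'}
                             (U : IsUltrafilter 𝒰) where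
  open IsUltrafilter U

  empty∉ : ∀ {S : Pred Y ℓ} → (∀ {y} → y ∉ S) → S ∉ 𝒰
  empty∉ S-empty S∈ = no-empty (up-closed (λ y∈S → ⊥-elim (S-empty y∈S)) S∈)

  member-of-finite-cover : ∀ {n} (A : Fin n → Pred Y ℓ) {S : Pred Y ℓ} → S ∈ 𝒰
    → (∀ {y} → y ∈ S → ∃ λ j → y ∈ A j) → ∃ λ j → A j ∈ 𝒰
  member-of-finite-cover {zero} A {S} S∈ cover = ⊥-elim (empty∉ no-colour S∈)
    where
      no-colour : ∀ {y} → y ∉ S
      no-colour y∈S with () ← proj₁ (cover y∈S)
  member-of-finite-cover {suc n} A {S} S∈ cover with ultra (A zero)
  ... | inj₁ A₀∈ = zero , A₀∈
  ... | inj₂ ∁A₀∈ =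
    let j , Aj∈ = member-of-finite-cover (λ j → A (suc j)) (∩-closed S∈ ∁A₀∈) cover-rest
    in suc j , Aj∈
    where
      cover-rest : ∀ {y} → y ∈ (S ∩ ∁ (A zero)) → ∃ λ j → y ∈ A (suc j)
      cover-rest (y∈S , y∉A₀) with cover y∈S
      ... | zero  , y∈A₀ = ⊥-elim (y∉A₀ y∈A₀)
      ... | suc j , y∈Aj = j , y∈Aj

module FibreIndex {a b} {Y : Set a} {X : Set b} {π : Y → X} {n : ℕ}
                  (ι : FibresAtMost π n) where
  open Injection using (to; injective)

  index : Y → Fin n
  index y = to (ι (π y)) (y , refl)

  index-along : ∀ {y x} (e : π y ≡ x) → index y ≡ to (ι x) (y , e)
  index-along refl = refl

  index-injective-on-fibres : ∀ {y y'} → π y ≡ π y' → index y ≡ index y' → y ≡ y'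
  index-injective-on-fibres {y} {y'} p same-index =
    cong proj₁ (injective (ι (π y')) (trans (sym (index-along p)) same-index))

  IndexClass : ∀ ℓ → Fin n → Pred Y ℓ
  IndexClass ℓ j y = Lift ℓ (index y ≡ j)

  IndexClass-atMostOnePerFibre : ∀ {ℓ} j → AtMostOnePerFibre π (IndexClass ℓ j)
  IndexClass-atMostOnePerFibre j y y' (lift refl) (lift same-index) p =
    index-injective-on-fibres p (sym same-index)

lemma6p5 : ∀ {a b ℓ ℓ'} {X : Set b} {Y : Set a} (π : Y → X) (n : ℕ)
    → Surjective π → FibresAtMost π n
    → (𝒰 : Pred (Pred Y ℓ) ℓ') → IsUltrafilter 𝒰
    → ∀ (W̃ : Pred Y ℓ) → W̃ ∈ 𝒰
    → ∃ λ (W : Pred Y ℓ) → W ∈ 𝒰 × W ⊆ W̃ × AtMostOnePerFibre π W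
lemma6p5 {ℓ = ℓ} π n _ ι 𝒰 U W̃ W̃∈ =
  let j , class∈ = member-of-finite-cover (IndexClass ℓ) W̃∈ (λ {y} _ → index y , lift refl)
  in W̃ ∩ IndexClass ℓ j , ∩-closed W̃∈ class∈ , proj₁ ,
     λ y y' (_ , y∈class) (_ , y'∈class) → IndexClass-atMostOnePerFibre j y y' y∈class y'∈class
  where
    open IsUltrafilter U using (∩-closed)
    open UltrafilterProperties U using (member-of-finite-cover)
    open FibreIndex ι
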